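{- Let $x\in\mathcal S$ and let $\varepsilon>0$ be smaller than every nonzero value among $x(e)$ and $b(e)-x(e)$ ($e\in E$), and smaller than $x(e)-x(e')$ for all $w\in W^=$, $e\in H_w(x)$, $e'\in\pi^c_w(x)\setminus H_w(x)$. Let $x'\in\mathcal S$ satisfy $x'\prec_F x$ and $|x'-x|=\varepsilon$. If $f\in F^=$ and $x'_f\ne x_f$, then: $\pi^c_f(x')$ is not better than $\pi^c_f(x)$; $H_f(x')=\{e\in E_f: x'(e)>x(e)\}$; if $\pi^c_f(x')=\pi^c_f(x)$ then $H_f(x')\subseteq H_f(x)$; and moreover $\pi^c_f(x')=\hat\pi_f(x)$ and $H_f(x')=D_f(x)$.
   Context: Setting. $G=(V,E)$ finite bipartite with classes $F,W$; edges $fw$; capacities $b>0$ on $E$, quotas $q>0$ on $V$; for $v\in V$, $E_v$ = edges at $v$, weakly ordered by an ordered partition $\Pi_v=(\pi^1,\dots,\pi^k)$ into ties ($\pi^i$ better than $\pi^j$ if $i<j$). $a(S)=\sum_{e\in S}a(e)$, $|a|=\sum_e|a(e)|$, $a_v=a|_{E_v}$. Assignment: $0\le x\le b$, $x(E_v)\le q(v)$. If $x(E_v)=q(v)$ ($v$ fully filled): critical tie $\pi^c_v(x)$ = tie $\pi^i$ with $x(\pi^1\cup\dots\cup\pi^{i-1})<q(v)\le x(\pi^1\cup\dots\cup\pi^i)$; head $H_v(x)$ = edges of $\pi^c_v(x)$ of maximal $x$-value in it; tail $T_v(x)$ = edges of better ties plus $\pi^c_v(x)\setminus H_v(x)$.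 If $x(E_v)<q(v)$ ($v$ deficit): $H_v=\emptyset$, $T_v=E_v$. Stable: no $fw$ with $x(fw)<b(fw)$, $fw\in T_f(x)\cap T_w(x)$; $\mathcal S$ = stable assignments. Preferences: $C_v(z)=z$ if $z(E_v)\le q(v)$, otherwise keep $z$ on ties better than the tie $\pi^i$ with $z(\pi^1\cup\dots\cup\pi^{i-1})<q(v)\le z(\pi^1\cup\dots\cup\pi^i)$, $0$ on worse ties and $\min\{r,z(e)\}$ on $\pi^i$ with $r$ making the total $q(v)$; $z\succeq_v z'$ iff $C_v(z\vee z')=z$; $x\succeq_F y$ iff $x_f\succeq_f y_f$ for all $f\in F$; $x\succ_F y$ iff moreover $x\ne y$. Known: the set of fully filled vertices is the same for all stable assignments; $F^=$, $W^=$ are the vertices of $F$, $W$ fully filled by $x$. For $f\in F^=$ and tie $\pi^i\in\Pi_f$: $D^i_f(x)=\{fw\in\pi^i: x(fw)<b(fw),\ fw\in T_w(x)\}$; $\hat\Pi_f(x)$ is the set of ties $\pi^i$ with $D^i_f(x)\ne\emptyset$ such that no tie equal to or better than $\pi^i$ contains an edge $fw$ with $x(fw)<b(fw)$ and $w$ deficit; $\hat\pi_f(x)$ is the best tie in $\hat\Pi_f(x)$ and $D_f(x)=D^i_f(x)$ for $\pi^i=\hat\pi_f(x)$ (if $\hat\Pi_f(x)=\emptyset$, $D_f(x)=\emptyset$).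
   Formalization: The capacities $b$, the quotas $q$, all assignments including $x$ and $x'$, and $\varepsilon$ take rational values. -}

module Defs where

open import Data.Nat using (ℕ) renaming (_≤_ to _≤ℕ_; _<_ to _<ℕ_)
open import Data.Fin using (Fin; _≟_)
open import Data.Bool using (Bool; true; false; T; if_then_else_)
open import Data.List using (List; foldr)
open import Data.List.Base using () renaming (allFin to allFinL)
open import Data.Rational using (ℚ; 0ℚ; _+_; _-_; _≤_; _<_; _⊔_; _⊓_; ∣_∣)
open import Data.Product using (Σ; _×_; ∃)
open import Data.Sum using (_⊎_)
open import Relation.Nullary using (¬_)
open import Relation.Nullary.Decidable using (⌊_⌋)
open import Relation.Binary.PropositionalEquality using (_≡_; _≢_)
open import Function.Bundles using (_⇔_)

-- F = Fin nF, W = Fin nW, E = Fin m; edge e joins fE e and wE e.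
-- The weak order Π_v on E_v is encoded by a rank function (smaller = better,
-- equal rank at the same vertex = same tie): rF e is the rank of e in the
-- list of fE e, rW e its rank in the list of wE e.

record Instance : Set where
  field
    nF nW m : ℕ
    fE : Fin m → Fin nF
    wE : Fin m → Fin nW
    simple : ∀ e e' → fE e ≡ fE e' → wE e ≡ wE e' → e ≡ e'
    b : Fin m → ℚ
    b-pos : ∀ e → 0ℚ < b e
    qF : Fin nF → ℚ
    qF-pos : ∀ f → 0ℚ < qF f
    qW : Fin nW → ℚ
    qW-pos : ∀ w → 0ℚ < qW w
    rF : Fin m → ℕ
    rW : Fin m → ℕ

sumWhere : ∀ {m} → (Fin m → Bool) → (Fin m → ℚ) → ℚ
sumWhere {m} p a = foldr (λ e acc → if p e then a e + acc else acc) 0ℚ (allFinL m)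

_≤ᵇ_ : ℕ → ℕ → Bool
i ≤ᵇ j = ⌊ Data.Nat._≤?_ i j ⌋
  where import Data.Nat

_<ᵇ_ : ℕ → ℕ → Bool
i <ᵇ j = ⌊ Data.Nat._<?_ i j ⌋
  where import Data.Nat

_∧_ : Bool → Bool → Bool
true ∧ c = c
false ∧ c = false

-- Vertex-local notions.  A vertex v is given by:
--   at : Fin m → Bool  (e ∈ E_v),  rk : Fin m → ℕ (tie rank at v),  q : ℚ (quota).

module Local {m : ℕ} (at : Fin m → Bool) (rk : Fin m → ℕ) (q : ℚ) where

  load : (Fin m → ℚ) → ℚ
  load z = sumWhere at z

  -- z(π^1 ∪ … ∪ π^{c-1}) and z(π^1 ∪ … ∪ π^c)
  before : (Fin m → ℚ) → ℕ → ℚ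
  before z c = sumWhere (λ e → at e ∧ (rk e <ᵇ c)) z

  upto : (Fin m → ℚ) → ℕ → ℚ
  upto z c = sumWhere (λ e → at e ∧ (rk e ≤ᵇ c)) z

  Full : (Fin m → ℚ) → Set
  Full x = load x ≡ q

  IsCrit : (Fin m → ℚ) → ℕ → Set
  IsCrit z c = (before z c < q) × (q ≤ upto z c)

  InH : (Fin m → ℚ) → Fin m → Set
  InH x e = Full x × Σ ℕ λ c → IsCrit x c × T (at e) × rk e ≡ c
              × (∀ e' → T (at e') → rk e' ≡ c → x e' ≤ x e)

  InT : (Fin m → ℚ) → Fin m → Set
  InT x e = T (at e) × (¬ Full x ⊎ Σ ℕ λ c → IsCrit x c × Full x
              × (rk e <ℕ c ⊎ (rk e ≡ c × ¬ InH x e)))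

  IsChoice : (Fin m → ℚ) → (Fin m → ℚ) → Set
  IsChoice z y =
      (load z ≤ q × (∀ e → T (at e) → y e ≡ z e))
    ⊎ (q < load z × Σ ℕ λ c → IsCrit z c × Σ ℚ λ r →
         (∀ e → T (at e) → rk e <ℕ c → y e ≡ z e)
       × (∀ e → T (at e) → c <ℕ rk e → y e ≡ 0ℚ)
       × (∀ e → T (at e) → rk e ≡ c → y e ≡ r ⊓ z e)
       × load y ≡ q)

  -- z ⪰_v z'  iff  C_v(z ∨ z') = z  (on E_v)
  Prefers : (Fin m → ℚ) → (Fin m → ℚ) → Set
  Prefers z z' = Σ (Fin m → ℚ) λ y → IsChoice (λ e → z e ⊔ z' e) y
                   × (∀ e → T (at e) → y e ≡ z e)

module Model (I : Instance) where
  open Instance I public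

  atF : Fin nF → Fin m → Bool
  atF f e = ⌊ fE e ≟ f ⌋

  atW : Fin nW → Fin m → Bool
  atW w e = ⌊ wE e ≟ w ⌋

  module LF (f : Fin nF) = Local (atF f) rF (qF f)
  module LW (w : Fin nW) = Local (atW w) rW (qW w)

  Assignment : (Fin m → ℚ) → Set
  Assignment x = (∀ e → 0ℚ ≤ x e) × (∀ e → x e ≤ b e)
               × (∀ f → LF.load f x ≤ qF f) × (∀ w → LW.load w x ≤ qW w)

  Stable : (Fin m → ℚ) → Set
  Stable x = Assignment x ×
    (∀ e → x e < b e → ¬ (LF.InT (fE e) x e × LW.InT (wE e) x e))

  PrefF : (Fin m → ℚ) → (Fin m → ℚ) → Set
  PrefF x y = ∀ f → LF.Prefers f x y

  StrictPrefF : (Fin m → ℚ) → (Fin m → ℚ) → Set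
  StrictPrefF x y = PrefF x y × ¬ (∀ e → x e ≡ y e)

  norm : (Fin m → ℚ) → ℚ
  norm a = sumWhere (λ _ → true) (λ e → ∣ a e ∣)

  InDi : Fin nF → (Fin m → ℚ) → ℕ → Fin m → Set
  InDi f x i e = T (atF f e) × rF e ≡ i × x e < b e × LW.InT (wE e) x e

  InHatPi : Fin nF → (Fin m → ℚ) → ℕ → Set
  InHatPi f x i = (∃ λ e → InDi f x i e)
    × (∀ e → T (atF f e) → rF e ≤ℕ i → x e < b e → LW.Full (wE e) x)

  IsHatPi : Fin nF → (Fin m → ℚ) → ℕ → Set
  IsHatPi f x i = InHatPi f x i × (∀ j → InHatPi f x j → i ≤ℕ j)

  -- e ∈ D_f(x)  (empty if \hat Π_f(x) = ∅)
  InD : Fin nF → (Fin m → ℚ) → Fin m → Set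
  InD f x e = Σ ℕ λ i → IsHatPi f x i × InDi f x i e

-- Loads are conserved.  Since x ⪰_F x', no firm's load grows.  Because ε is below every
-- positive value of x and of b − x, an edge that decreases stays positive and unsaturated in
-- x'; it lies in its firm's tail, so stability of x' makes it a head of its worker, which is
-- therefore full.  Hence no worker's load drops, and double counting
-- Σ_f x(E_f) = Σ_e x(e) = Σ_w x(E_w) shows that no load changes at all.  The same ε-bounds
-- show that a full worker keeps its critical tie and that its heads in x' were heads in x, so
-- worker tails only grow.  At a firm f whose allocation changed, x ⪰_f x' says that x cuts
-- x ∨ x' at its critical tie; with stability this makes the heads of f in x' exactly the
-- edges that increased, which in turn are the edges of D_f(x).

{-# OPTIONS --safe #-}
module Submission where

open import Defs
open import Data.Nat using (ℕ) renaming (_≤_ to _≤ℕ_)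
open import Data.Fin using (Fin)
open import Data.Bool using (T)
open import Data.Rational using (ℚ; 0ℚ; _-_; _<_)
open import Data.Product using (Σ; _×_)
open import Relation.Nullary using (¬_)
open import Relation.Binary.PropositionalEquality using (_≡_; _≢_)
open import Function.Bundles using (_⇔_)

open import Data.Bool using (Bool; true; false; if_then_else_)
open import Data.Fin using (zero; suc) renaming (_≟_ to _≟ᶠ_)
open import Data.Fin.Properties using (all?; ¬∀⟶∃¬)
open import Data.List using (List; foldr; tabulate; filter)
open import Data.List.Base using () renaming (allFin to allFinL)
open import Data.List.Membership.Propositional.Properties using (∈-filter⁺; ∈-allFin)
open import Data.List.Relation.Unary.All using (lookup)
open import Data.List.Relation.Unary.All.Properties using (all-filter)
open import Data.Nat as ℕ using (zero; suc) renaming (_<_ to _<ℕ_)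
import Data.Nat.Properties as ℕ
open import Data.Product using (∃; _,_; proj₁; proj₂)
open import Data.Rational using (_+_; _≤_; ∣_∣; -_; _⊓_; _⊔_; _≟_)
open import Data.Rational.Properties
open import Data.Rational.Solver using (module +-*-Solver)
open import Data.Sum using (_⊎_; inj₁; inj₂; [_,_]′)
open import Function using (_∘_; id; case_of_)
open import Function.Bundles using (mk⇔)
open import Relation.Binary.Bundles using (DecTotalOrder)
open import Relation.Binary.Definitions using (tri<; tri≈; tri>)
open import Relation.Binary.PropositionalEquality using (refl; sym; trans; cong; subst; module ≡-Reasoning)
open import Relation.Nullary using (yes; no; contradiction)
open import Relation.Nullary.Decidable using (⌊_⌋; toWitness; fromWitness; T?; _×-dec_; decidable-stable)
open import Relation.Unary using (Decidable)

open import Algebra.Properties.CommutativeMonoid.Sum +-0-commutativeMonoid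
  using (sum; sum-syntax; ∑-comm; sum-cong-≗; sum-replicate-zero)
open import Data.List.Extrema (DecTotalOrder.totalOrder ≤-decTotalOrder)
  using (argmax; f[xs]≤f[argmax]; argmax-all)

NonNeg : ∀ {m} → (Fin m → ℚ) → Set
NonNeg z = ∀ e → 0ℚ ≤ z e

<⇒≱ : ∀ {p q} → p < q → ¬ q ≤ p
<⇒≱ p<q q≤p = <-irrefl refl (<-≤-trans p<q q≤p)

p≤∣p∣ : ∀ p → p ≤ ∣ p ∣
p≤∣p∣ p with ≤-total 0ℚ p
... | inj₁ 0≤p = ≤-reflexive (sym (0≤p⇒∣p∣≡p 0≤p))
... | inj₂ p≤0 = ≤-trans p≤0 (0≤∣p∣ p)

-p≤∣p∣ : ∀ p → - p ≤ ∣ p ∣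
-p≤∣p∣ p = subst (- p ≤_) (∣-p∣≡∣p∣ p) (p≤∣p∣ (- p))

module _ where
  open +-*-Solver

  p≤q+∣p-q∣ : ∀ p q → p ≤ q + ∣ p - q ∣
  p≤q+∣p-q∣ p q = subst (_≤ q + ∣ p - q ∣) (solve 2 (λ p q → q :+ (p :- q) := p) refl p q)
    (+-monoʳ-≤ q (p≤∣p∣ (p - q)))

  q≤p+∣p-q∣ : ∀ p q → q ≤ p + ∣ p - q ∣
  q≤p+∣p-q∣ p q = subst (_≤ p + ∣ p - q ∣) (solve 2 (λ p q → p :+ (:- (p :- q)) := q) refl p q)
    (+-monoʳ-≤ p (-p≤∣p∣ (p - q)))

  p<q⇒q-p≢0 : ∀ {p q} → p < q → q - p ≢ 0ℚ
  p<q⇒q-p≢0 {p} {q} p<q q-p≡0 = <-irrefl (sym q≡p) p<q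
    where
    q≡p : q ≡ p
    q≡p = trans (solve 2 (λ p q → q := (q :- p) :+ p) refl p q) (trans (cong (_+ p) q-p≡0) (+-identityˡ p))

  r<q-p⇒p+r<q : ∀ {p q r} → r < q - p → p + r < q
  r<q-p⇒p+r<q {p} {q} lt = subst (p + _ <_) (solve 2 (λ p q → p :+ (q :- p) := q) refl p q)
    (+-monoʳ-< p lt)

-- Finite sums

∑-mono-≤ : ∀ {n} {f g : Fin n → ℚ} → (∀ i → f i ≤ g i) → sum f ≤ sum g
∑-mono-≤ {zero}  f≤g = ≤-refl
∑-mono-≤ {suc n} f≤g = +-mono-≤ (f≤g zero) (∑-mono-≤ (f≤g ∘ suc))

∑-mono-< : ∀ {n} {f g : Fin n → ℚ} → (∀ i → f i ≤ g i) → ∀ i → f i < g i → sum f < sum g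
∑-mono-< f≤g zero    lt = +-mono-<-≤ lt (∑-mono-≤ (f≤g ∘ suc))
∑-mono-< f≤g (suc i) lt = +-mono-≤-< (f≤g zero) (∑-mono-< (f≤g ∘ suc) i lt)

∑-nonneg : ∀ {n} {f : Fin n → ℚ} → NonNeg f → 0ℚ ≤ sum f
∑-nonneg {n} {f} 0≤f = subst (_≤ sum f) (sum-replicate-zero n) (∑-mono-≤ 0≤f)

term≤∑ : ∀ {n} {f : Fin n → ℚ} → NonNeg f → ∀ i → f i ≤ sum f
term≤∑ {f = f} 0≤f zero    = subst (_≤ sum f) (+-identityʳ (f zero))
  (+-monoʳ-≤ (f zero) (∑-nonneg (0≤f ∘ suc)))
term≤∑ {f = f} 0≤f (suc i) = subst (_≤ sum f) (+-identityˡ (f (suc i)))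
  (+-mono-≤ (0≤f zero) (term≤∑ (0≤f ∘ suc) i))

pair≤∑ : ∀ {n} {f : Fin n → ℚ} → NonNeg f → ∀ {i j} → i ≢ j → f i + f j ≤ sum f
pair≤∑ 0≤f {zero}  {zero}  i≢j = contradiction refl i≢j
pair≤∑ {f = f} 0≤f {zero}  {suc j} i≢j = +-monoʳ-≤ (f zero) (term≤∑ (0≤f ∘ suc) j)
pair≤∑ {f = f} 0≤f {suc i} {zero}  i≢j = subst (_≤ sum f) (+-comm (f zero) (f (suc i)))
  (+-monoʳ-≤ (f zero) (term≤∑ (0≤f ∘ suc) i))
pair≤∑ {f = f} 0≤f {suc i} {suc j} i≢j = subst (_≤ sum f) (+-identityˡ (f (suc i) + f (suc j)))
  (+-mono-≤ (0≤f zero) (pair≤∑ (0≤f ∘ suc) (i≢j ∘ cong suc)))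

∑-pointwise-≡ : ∀ {n} {f g : Fin n → ℚ} → (∀ i → f i ≤ g i) → sum g ≤ sum f → ∀ i → f i ≡ g i
∑-pointwise-≡ f≤g ∑g≤∑f i =
  ≤-antisym (f≤g i) (≮⇒≥ (λ fi<gi → <⇒≱ (∑-mono-< f≤g i fi<gi) ∑g≤∑f))

∑-≢⇒∃< : ∀ {n} {f g : Fin n → ℚ} → sum f ≤ sum g → ¬ (∀ i → f i ≡ g i) → ∃ λ i → f i < g i
∑-≢⇒∃< {n} {f} {g} ∑f≤∑g f≢g with all? (λ i → g i ≤? f i)
... | yes g≤f = contradiction (λ i → sym (∑-pointwise-≡ g≤f ∑f≤∑g i)) f≢g
... | no g≰f = let i , gi≰fi = ¬∀⟶∃¬ n _ (λ i → g i ≤? f i) g≰f in i , ≰⇒> gi≰fi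

select : ∀ {m} → (Fin m → Bool) → (Fin m → ℚ) → Fin m → ℚ
select p a e = if p e then a e else 0ℚ

sumWhere≡∑select : ∀ {m} (p : Fin m → Bool) (a : Fin m → ℚ) → sumWhere p a ≡ sum (select p a)
sumWhere≡∑select {m} p a = over-tabulate id
  where
  over-tabulate : ∀ {n} (h : Fin n → Fin m) →
       foldr (λ e acc → if p e then a e + acc else acc) 0ℚ (tabulate h) ≡ sum (select p a ∘ h)
  over-tabulate {zero}  h = refl
  over-tabulate {suc n} h with p (h zero)
  ... | true  = cong (a (h zero) +_) (over-tabulate (h ∘ suc))
  ... | false = trans (over-tabulate (h ∘ suc)) (sym (+-identityˡ _))

module _ {m : ℕ} (p : Fin m → Bool) where

  select-mono-≤ : ∀ (a a' : Fin m → ℚ) e → (T (p e) → a e ≤ a' e) → select p a e ≤ select p a' e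
  select-mono-≤ a a' e h with p e
  ... | true  = h _
  ... | false = ≤-refl

  select-mono-< : ∀ (a a' : Fin m → ℚ) e → T (p e) → a e < a' e → select p a e < select p a' e
  select-mono-< a a' e pe lt with p e
  ... | true  = lt

  select-≡⇒ : ∀ (a a' : Fin m → ℚ) e → T (p e) → select p a e ≡ select p a' e → a e ≡ a' e
  select-≡⇒ a a' e pe eq with p e
  ... | true  = eq

  select-<⇒ : ∀ (a a' : Fin m → ℚ) e → select p a e < select p a' e → T (p e) × a e < a' e
  select-<⇒ a a' e lt with p e
  ... | true  = _ , lt
  ... | false = contradiction lt (<-irrefl refl)

  module _ (p' : Fin m → Bool) (a : Fin m → ℚ) (e : Fin m) where

    select-⊆ : 0ℚ ≤ a e → (T (p e) → T (p' e)) → select p a e ≤ select p' a e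
    select-⊆ 0≤a p⊆p' with p e | p' e
    ... | true  | true  = ≤-refl
    ... | true  | false = contradiction _ p⊆p'
    ... | false | true  = 0≤a
    ... | false | false = ≤-refl

    select-⊆-< : T (p' e) → ¬ T (p e) → 0ℚ < a e → select p a e < select p' a e
    select-⊆-< p'e ¬pe 0<a with p e | p' e
    ... | true  | _     = contradiction _ ¬pe
    ... | false | true  = 0<a

    select-⊇-≡ : (T (p' e) → T (p e)) → (T (p e) → ¬ T (p' e) → a e ≡ 0ℚ) →
                 select p a e ≡ select p' a e
    select-⊇-≡ p'⊆p vanish with p e | p' e
    ... | true  | true  = refl
    ... | true  | false = vanish _ id
    ... | false | true  = contradiction (p'⊆p _) id
    ... | false | false = refl

    select-⊆-<⇒ : (T (p e) → T (p' e)) → select p a e < select p' a e → T (p' e) × ¬ T (p e) × 0ℚ < a e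
    select-⊆-<⇒ p⊆p' lt with p e | p' e
    ... | true  | true  = contradiction lt (<-irrefl refl)
    ... | true  | false = contradiction _ p⊆p'
    ... | false | true  = _ , id , lt
    ... | false | false = contradiction lt (<-irrefl refl)

module _ {m : ℕ} (p : Fin m → Bool) where

  sumWhere-mono-≤ : ∀ (a a' : Fin m → ℚ) → (∀ e → T (p e) → a e ≤ a' e) → sumWhere p a ≤ sumWhere p a'
  sumWhere-mono-≤ a a' a≤a' rewrite sumWhere≡∑select p a | sumWhere≡∑select p a' =
    ∑-mono-≤ (λ e → select-mono-≤ p a a' e (a≤a' e))

  sumWhere-mono-< : ∀ (a a' : Fin m → ℚ) → (∀ e → T (p e) → a e ≤ a' e) →
                    ∀ {e} → T (p e) → a e < a' e → sumWhere p a < sumWhere p a'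
  sumWhere-mono-< a a' a≤a' {e} pe lt rewrite sumWhere≡∑select p a | sumWhere≡∑select p a' =
    ∑-mono-< (λ e → select-mono-≤ p a a' e (a≤a' e)) e (select-mono-< p a a' e pe lt)

  sumWhere-cong : ∀ (a a' : Fin m → ℚ) → (∀ e → T (p e) → a e ≡ a' e) → sumWhere p a ≡ sumWhere p a'
  sumWhere-cong a a' a≡a' = ≤-antisym (sumWhere-mono-≤ a a' (λ e pe → ≤-reflexive (a≡a' e pe)))
                                      (sumWhere-mono-≤ a' a (λ e pe → ≤-reflexive (sym (a≡a' e pe))))

  sumWhere-≢⇒∃< : ∀ (a a' : Fin m → ℚ) → sumWhere p a ≤ sumWhere p a' →
                  ¬ (∀ e → T (p e) → a e ≡ a' e) →
                  ∃ λ e → T (p e) × a e < a' e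
  sumWhere-≢⇒∃< a a' ≤' a≢a' rewrite sumWhere≡∑select p a | sumWhere≡∑select p a' =
    let e , lt = ∑-≢⇒∃< ≤' (λ eq → a≢a' (λ e pe → select-≡⇒ p a a' e pe (eq e)))
    in e , select-<⇒ p a a' e lt

  sumWhere-<⇒∃< : ∀ (a a' : Fin m → ℚ) → sumWhere p a < sumWhere p a' → ∃ λ e → T (p e) × a e < a' e
  sumWhere-<⇒∃< a a' lt = sumWhere-≢⇒∃< a a' (<⇒≤ lt) (λ a≡a' → <-irrefl (sumWhere-cong a a' a≡a') lt)

  sumWhere-empty : ∀ (a : Fin m → ℚ) → (∀ e → ¬ T (p e)) → sumWhere p a ≡ 0ℚ
  sumWhere-empty a ¬p rewrite sumWhere≡∑select p a =
    trans (sum-cong-≗ (λ e → select-⊇-≡ p (λ _ → false) a e (λ ()) (λ pe _ → contradiction pe (¬p e))))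
          (sum-replicate-zero m)

  module _ (p' : Fin m → Bool) (a : Fin m → ℚ) where

    sumWhere-⊆ : NonNeg a → (∀ e → T (p e) → T (p' e)) → sumWhere p a ≤ sumWhere p' a
    sumWhere-⊆ 0≤a p⊆p' rewrite sumWhere≡∑select p a | sumWhere≡∑select p' a =
      ∑-mono-≤ (λ e → select-⊆ p p' a e (0≤a e) (p⊆p' e))

    sumWhere-⊆-< : NonNeg a → (∀ e → T (p e) → T (p' e)) →
                   ∀ {e} → T (p' e) → ¬ T (p e) → 0ℚ < a e → sumWhere p a < sumWhere p' a
    sumWhere-⊆-< 0≤a p⊆p' {e} p'e ¬pe 0<a rewrite sumWhere≡∑select p a | sumWhere≡∑select p' a =
      ∑-mono-< (λ e → select-⊆ p p' a e (0≤a e) (p⊆p' e)) e (select-⊆-< p p' a e p'e ¬pe 0<a)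

    sumWhere-⊆-<⇒∃ : (∀ e → T (p e) → T (p' e)) → sumWhere p a < sumWhere p' a →
                     ∃ λ e → T (p' e) × ¬ T (p e) × 0ℚ < a e
    sumWhere-⊆-<⇒∃ p⊆p' lt rewrite sumWhere≡∑select p a | sumWhere≡∑select p' a =
      let e , lt' = ∑-≢⇒∃< (<⇒≤ lt) (λ eq → <-irrefl (sum-cong-≗ eq) lt)
      in e , select-⊆-<⇒ p p' a e (p⊆p' e) lt'

    sumWhere-⊇-≡ : (∀ e → T (p' e) → T (p e)) → (∀ e → T (p e) → ¬ T (p' e) → a e ≡ 0ℚ) →
                   sumWhere p a ≡ sumWhere p' a
    sumWhere-⊇-≡ p'⊆p vanish rewrite sumWhere≡∑select p a | sumWhere≡∑select p' a =
      sum-cong-≗ (λ e → select-⊇-≡ p p' a e (p'⊆p e) (vanish e))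

term≤sumWhere : ∀ {m} {a : Fin m → ℚ} → NonNeg a → ∀ e → a e ≤ sumWhere (λ _ → true) a
term≤sumWhere {a = a} 0≤a e rewrite sumWhere≡∑select (λ _ → true) a = term≤∑ 0≤a e

pair≤sumWhere : ∀ {m} {a : Fin m → ℚ} → NonNeg a → ∀ {e e'} → e ≢ e' →
                a e + a e' ≤ sumWhere (λ _ → true) a
pair≤sumWhere {a = a} 0≤a e≢e' rewrite sumWhere≡∑select (λ _ → true) a = pair≤∑ 0≤a e≢e'

⌊suc≟suc⌋ : ∀ {n} (u v : Fin n) → ⌊ suc u ≟ᶠ suc v ⌋ ≡ ⌊ u ≟ᶠ v ⌋
⌊suc≟suc⌋ u v with u ≟ᶠ v
... | yes _ = refl
... | no _  = refl

∑-indicator : ∀ {n} (u : Fin n) (c : ℚ) → ∑[ v < n ] (if ⌊ u ≟ᶠ v ⌋ then c else 0ℚ) ≡ c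
∑-indicator {suc n} zero    c = trans (cong (c +_) (sum-replicate-zero n)) (+-identityʳ c)
∑-indicator {suc n} (suc u) c = begin
  0ℚ + ∑[ v < n ] (if ⌊ suc u ≟ᶠ suc v ⌋ then c else 0ℚ)
    ≡⟨ +-identityˡ _ ⟩
  ∑[ v < n ] (if ⌊ suc u ≟ᶠ suc v ⌋ then c else 0ℚ)
    ≡⟨ sum-cong-≗ (cong (if_then c else 0ℚ) ∘ ⌊suc≟suc⌋ u) ⟩
  ∑[ v < n ] (if ⌊ u ≟ᶠ v ⌋ then c else 0ℚ)
    ≡⟨ ∑-indicator u c ⟩
  c ∎
  where open ≡-Reasoning

∑-fibres : ∀ {m n} (g : Fin m → Fin n) (a : Fin m → ℚ) →
           ∑[ v < n ] sumWhere (λ e → ⌊ g e ≟ᶠ v ⌋) a ≡ sum a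
∑-fibres {m} {n} g a = begin
  ∑[ v < n ] sumWhere (fibre v) a              ≡⟨ sum-cong-≗ (λ v → sumWhere≡∑select (fibre v) a) ⟩
  ∑[ v < n ] ∑[ e < m ] select (fibre v) a e   ≡⟨ ∑-comm (λ v e → select (fibre v) a e) ⟩
  ∑[ e < m ] ∑[ v < n ] select (fibre v) a e   ≡⟨ sum-cong-≗ (λ e → ∑-indicator (g e) (a e)) ⟩
  sum a                                        ∎
  where
  open ≡-Reasoning
  fibre : Fin n → Fin m → Bool
  fibre v e = ⌊ g e ≟ᶠ v ⌋

-- Critical tie, head and tail at a single vertex

∧-intro : ∀ {a b} → T a → T b → T (a ∧ b)
∧-intro {true} _ tb = tb

∧-elim : ∀ {a b} → T (a ∧ b) → T a × T b
∧-elim {true} tb = _ , tb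

ℕ-bounded : ∀ {n} (f : Fin n → ℕ) → ∃ λ N → ∀ i → f i ≤ℕ N
ℕ-bounded {zero}  f = 0 , λ ()
ℕ-bounded {suc n} f with ℕ-bounded (f ∘ suc)
... | N , f≤N = f zero ℕ.⊔ N , λ where
  zero    → ℕ.m≤m⊔n (f zero) N
  (suc i) → ℕ.m≤n⇒m≤o⊔n (f zero) (f≤N i)

threshold-crossing : ∀ (g : ℕ → ℚ) {q} N → g 0 < q → q ≤ g (suc N) → ∃ λ c → g c < q × q ≤ g (suc c)
threshold-crossing g zero    g0<q q≤g1 = 0 , g0<q , q≤g1
threshold-crossing g {q} (suc N) g0<q q≤g with q ≤? g (suc N)
... | yes q≤gN = threshold-crossing g N g0<q q≤gN
... | no  q≰gN = suc N , ≰⇒> q≰gN , q≤g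

argmax-on : ∀ {n} {P : Fin n → Set} → Decidable P → (f : Fin n → ℚ) → ∀ {i} → P i →
         ∃ λ j → P j × (∀ k → P k → f k ≤ f j)
argmax-on {n} P? f {i} Pi =
  argmax f i candidates ,
  argmax-all f Pi (all-filter P? (allFinL n)) ,
  λ k Pk → lookup (f[xs]≤f[argmax] i candidates) (∈-filter⁺ P? (∈-allFin k) Pk)
  where
  candidates : List (Fin n)
  candidates = filter P? (allFinL n)

module Vertex {m : ℕ} (at : Fin m → Bool) (rk : Fin m → ℕ) (q : ℚ) (0<q : 0ℚ < q) where
  open Local at rk q

  Before Upto : ℕ → Fin m → Bool
  Before c e = at e ∧ (rk e <ᵇ c)
  Upto   c e = at e ∧ (rk e ≤ᵇ c)

  inBefore⁺ : ∀ {e c} → T (at e) → rk e <ℕ c → T (Before c e)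
  inBefore⁺ ae lt = ∧-intro ae (fromWitness lt)

  inBefore⁻ : ∀ {e c} → T (Before c e) → T (at e) × rk e <ℕ c
  inBefore⁻ t = let ae , lt = ∧-elim t in ae , toWitness lt

  inUpto⁺ : ∀ {e c} → T (at e) → rk e ≤ℕ c → T (Upto c e)
  inUpto⁺ ae le = ∧-intro ae (fromWitness le)

  inUpto⁻ : ∀ {e c} → T (Upto c e) → T (at e) × rk e ≤ℕ c
  inUpto⁻ t = let ae , le = ∧-elim t in ae , toWitness le

  module _ {z : Fin m → ℚ} (z≥0 : NonNeg z) where

    upto≤before : ∀ {c c'} → c <ℕ c' → upto z c ≤ before z c'
    upto≤before {c} {c'} c<c' = sumWhere-⊆ (Upto c) (Before c') z z≥0
      (λ e t → let ae , le = inUpto⁻ t in inBefore⁺ ae (ℕ.≤-<-trans le c<c'))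

    upto≤load : ∀ c → upto z c ≤ load z
    upto≤load c = sumWhere-⊆ (Upto c) at z z≥0 (λ e → proj₁ ∘ ∧-elim)

    IsCrit-≮ : ∀ {c c'} → IsCrit z c → IsCrit z c' → ¬ c <ℕ c'
    IsCrit-≮ (_ , q≤upto) (before<q , _) c<c' = <⇒≱ before<q (≤-trans q≤upto (upto≤before c<c'))

    IsCrit-unique : ∀ {c c'} → IsCrit z c → IsCrit z c' → c ≡ c'
    IsCrit-unique cr cr' = ℕ.≤-antisym (ℕ.≮⇒≥ (IsCrit-≮ cr' cr)) (ℕ.≮⇒≥ (IsCrit-≮ cr cr'))

    before≡0 : before z 0 ≡ 0ℚ
    before≡0 = sumWhere-empty (Before 0) z (λ e t → ℕ.n≮0 (proj₂ (inBefore⁻ t)))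

    before-suc : ∀ c → before z (suc c) ≡ upto z c
    before-suc c = sumWhere-⊇-≡ (Before (suc c)) (Upto c) z
      (λ e t → let ae , le = inUpto⁻ t in inBefore⁺ ae (ℕ.s≤s le))
      (λ e t ¬t → let ae , lt = inBefore⁻ t in contradiction (inUpto⁺ ae (ℕ.≤-pred lt)) ¬t)

    load≡before : ∀ {N} → (∀ e → rk e ≤ℕ N) → load z ≡ before z (suc N)
    load≡before rk≤N = sumWhere-⊇-≡ at (Before (suc _)) z
      (λ e → proj₁ ∘ inBefore⁻)
      (λ e ae ¬t → contradiction (inBefore⁺ ae (ℕ.s≤s (rk≤N e))) ¬t)

    IsCrit-exists : Full z → ∃ (IsCrit z)
    IsCrit-exists full =
      let N , rk≤N = ℕ-bounded rk
          c , before<q , q≤before = threshold-crossing (before z) N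
            (subst (_< q) (sym before≡0) 0<q)
            (≤-reflexive (trans (sym full) (load≡before rk≤N)))
      in c , before<q , subst (q ≤_) (before-suc c) q≤before

    zero-above-crit : Full z → ∀ {c} → IsCrit z c → ∀ {e} → T (at e) → c <ℕ rk e → z e ≡ 0ℚ
    zero-above-crit full {c} (_ , q≤upto) {e} ae c<rk = ≤-antisym (≮⇒≥ z[e]≯0) (z≥0 e)
      where
      z[e]≯0 : ¬ 0ℚ < z e
      z[e]≯0 0<z = <⇒≱ (sumWhere-⊆-< (Upto c) at z z≥0 (λ e → proj₁ ∘ ∧-elim) ae
                          (λ t → ℕ.<⇒≱ c<rk (proj₂ (inUpto⁻ t))) 0<z)
                       (≤-trans (≤-reflexive full) q≤upto)

    InH-at : ∀ {e} → InH z e → T (at e)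
    InH-at (_ , _ , _ , ae , _) = ae

    InH-rank : ∀ {e c} → InH z e → IsCrit z c → rk e ≡ c
    InH-rank (_ , c' , cr' , _ , rk≡c' , _) cr = trans rk≡c' (IsCrit-unique cr' cr)

    InH-max : ∀ {e e'} → InH z e → T (at e') → rk e' ≡ rk e → z e' ≤ z e
    InH-max (_ , c , _ , _ , rk≡c , max) ae' rk≡ = max _ ae' (trans rk≡ rk≡c)

    InH-≡ : ∀ {e e'} → InH z e → InH z e' → z e ≡ z e'
    InH-≡ h@(_ , c , cr , ae , _) h'@(_ , _ , _ , ae' , _) =
      ≤-antisym (InH-max h' ae (trans (InH-rank h cr) (sym (InH-rank h' cr))))
                (InH-max h ae' (trans (InH-rank h' cr) (sym (InH-rank h cr))))

    InH-exists : Full z → ∀ {c} → IsCrit z c → ∀ {e} → T (at e) → rk e ≡ c → ∃ (InH z)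
    InH-exists full {c} cr ae rk≡c =
      let h , (ah , rh≡c) , max = argmax-on (λ e → T? (at e) ×-dec (rk e ℕ.≟ c)) z (ae , rk≡c)
      in h , full , c , cr , ah , rh≡c , λ e' ae' re'≡c → max e' (ae' , re'≡c)

    InT-below : Full z → ∀ {c} → IsCrit z c → ∀ {e} → T (at e) → rk e <ℕ c → InT z e
    InT-below full cr ae lt = ae , inj₂ (_ , cr , full , inj₁ lt)

    InT-crit : Full z → ∀ {c} → IsCrit z c → ∀ {e} → T (at e) → rk e ≡ c → ¬ InH z e → InT z e
    InT-crit full cr ae eq ¬h = ae , inj₂ (_ , cr , full , inj₂ (eq , ¬h))

    InT-cases : ∀ {e} → InT z e → Full z → ∀ {c} → IsCrit z c → rk e <ℕ c ⊎ (rk e ≡ c × ¬ InH z e)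
    InT-cases (_ , inj₁ ¬full) full _ = contradiction full ¬full
    InT-cases (_ , inj₂ (c' , cr' , _ , inj₁ lt)) _ cr = inj₁ (subst (_ <ℕ_) (IsCrit-unique cr' cr) lt)
    InT-cases (_ , inj₂ (c' , cr' , _ , inj₂ (eq , ¬h))) _ cr = inj₂ (trans eq (IsCrit-unique cr' cr) , ¬h)

    InH⇒¬InT : ∀ {e} → InH z e → ¬ InT z e
    InH⇒¬InT h@(full , c , cr , _) t with InT-cases t full cr
    ... | inj₁ lt        = ℕ.<-irrefl (InH-rank h cr) lt
    ... | inj₂ (_ , ¬h)  = ¬h h

    ¬InT⇒InH : Full z → ∀ {c} → IsCrit z c → ∀ {e} → T (at e) → rk e ≡ c → ¬ InT z e → InH z e
    ¬InT⇒InH full {c} cr {e} ae rk≡c ¬t = full , c , cr , ae , rk≡c , max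
      where
      max : ∀ e' → T (at e') → rk e' ≡ c → z e' ≤ z e
      max e' ae' rk'≡c with z e' ≤? z e
      ... | yes le = le
      ... | no  z[e']≰z[e] =
        contradiction (InT-crit full cr ae rk≡c (λ h → z[e']≰z[e] (InH-max h ae' (trans rk'≡c (sym rk≡c))))) ¬t

    positive-¬InT⇒InH : ∀ {e} → T (at e) → 0ℚ < z e → ¬ InT z e → InH z e
    positive-¬InT⇒InH {e} ae 0<z ¬t = at-crit (proj₂ (IsCrit-exists full))
      where
      full : Full z
      full = decidable-stable (load z ≟ q) (λ ¬full → ¬t (ae , inj₁ ¬full))
      at-crit : ∀ {c} → IsCrit z c → InH z e
      at-crit {c} cr = case ℕ.<-cmp (rk e) c of λ where
        (tri< lt _ _) → contradiction (InT-below full cr ae lt) ¬t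
        (tri≈ _ eq _) → ¬InT⇒InH full cr ae eq ¬t
        (tri> _ _ gt) → contradiction (zero-above-crit full cr ae gt) (λ eq → <-irrefl (sym eq) 0<z)

  -- The case of z = C_v(z ∨ z') in which z ∨ z' overfills v; `cap` is the cut-off on the critical tie.
  record Cut (z z' : Fin m → ℚ) : Set where
    field
      crit   : ℕ
      cap    : ℚ
      full   : Full z
      isCrit : IsCrit z crit
      below  : ∀ e → T (at e) → rk e <ℕ crit → z' e ≤ z e
      atCrit : ∀ e → T (at e) → rk e ≡ crit → z e ≡ cap ⊓ (z e ⊔ z' e)

  Prefers⇒≤⊎Cut : ∀ {z z'} → Prefers z z' → (∀ e → T (at e) → z' e ≤ z e) ⊎ Cut z z'
  Prefers⇒≤⊎Cut {z} {z'} (y , inj₁ (_ , y≡z⊔z') , y≡z) =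
    inj₁ λ e ae → subst (z' e ≤_) (trans (sym (y≡z⊔z' e ae)) (y≡z e ae)) (p≤q⊔p (z e) (z' e))
  Prefers⇒≤⊎Cut {z} {z'} (y , inj₂ (_ , c , (before<q , _) , r , y-below , y-above , y-atCrit , load-y) , y≡z) =
    inj₂ record
      { crit   = c
      ; cap    = r
      ; full   = full
      ; isCrit = subst (_< q) before≡ before<q , ≤-reflexive (trans (sym full) load≡upto)
      ; below  = λ e ae lt → subst (z' e ≤_) (z⊔z'≡z e ae lt) (p≤q⊔p (z e) (z' e))
      ; atCrit = λ e ae eq → trans (sym (y≡z e ae)) (y-atCrit e ae eq)
      }
    where
    z⊔z'≡z : ∀ e → T (at e) → rk e <ℕ c → z e ⊔ z' e ≡ z e
    z⊔z'≡z e ae lt = trans (sym (y-below e ae lt)) (y≡z e ae)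
    full : Full z
    full = trans (sumWhere-cong at z y (λ e ae → sym (y≡z e ae))) load-y
    before≡ : before (λ e → z e ⊔ z' e) c ≡ before z c
    before≡ = sumWhere-cong (Before c) _ z (λ e t → let ae , lt = inBefore⁻ t in z⊔z'≡z e ae lt)
    load≡upto : load z ≡ upto z c
    load≡upto = sumWhere-⊇-≡ at (Upto c) z (λ e → proj₁ ∘ ∧-elim)
      (λ e ae ¬t → trans (sym (y≡z e ae)) (y-above e ae (ℕ.≰⇒> (¬t ∘ inUpto⁺ ae))))

  module CutProperties {z z' : Fin m → ℚ} (z≥0 : NonNeg z) (z'≥0 : NonNeg z') (cut : Cut z z') where
    open Cut cut public

    crit-≤ : ∀ {c'} → IsCrit z' c' → crit ≤ℕ c'
    crit-≤ {c'} (_ , q≤upto') = ℕ.≮⇒≥ λ c'<crit → <⇒≱ (proj₁ isCrit) (begin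
      q                ≤⟨ q≤upto' ⟩
      upto z' c'       ≤⟨ sumWhere-mono-≤ (Upto c') z' z
                            (λ e t → let ae , le = inUpto⁻ t in below e ae (ℕ.≤-<-trans le c'<crit)) ⟩
      upto z c'        ≤⟨ upto≤before z≥0 c'<crit ⟩
      before z crit    ∎)
      where open ≤-Reasoning

    ≤cap : ∀ {e} → T (at e) → rk e ≡ crit → z e ≤ cap
    ≤cap {e} ae eq = subst (_≤ cap) (sym (atCrit e ae eq)) (p⊓q≤p cap _)

    increase⇒cap : ∀ {e} → T (at e) → rk e ≡ crit → z e < z' e → z e ≡ cap
    increase⇒cap {e} ae eq lt =
      [ trans z≡cap⊓z' , (λ ≡z' → contradiction (trans z≡cap⊓z' ≡z') (λ z≡z' → <-irrefl z≡z' lt)) ]′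
        (⊓-sel cap (z' e))
      where
      z≡cap⊓z' : z e ≡ cap ⊓ z' e
      z≡cap⊓z' = trans (atCrit e ae eq) (cong (cap ⊓_) (p≤q⇒p⊔q≡q (<⇒≤ lt)))

    ≤cap⇒≤ : ∀ {e} → T (at e) → rk e ≡ crit → z' e ≤ cap → z' e ≤ z e
    ≤cap⇒≤ {e} ae eq z'≤cap = subst (z' e ≤_) (sym (atCrit e ae eq)) (⊓-glb z'≤cap (p≤q⊔p (z e) (z' e)))

    decrease⇒InT : Full z' → ∀ {g} → T (at g) → z' g < z g → InT z' g
    decrease⇒InT full' {g} ag z'<z = let c' , cr' = IsCrit-exists z'≥0 full' in InT-at cr'
      where
      0<z : 0ℚ < z g
      0<z = ≤-<-trans (z'≥0 g) z'<z

      rk≤crit : rk g ≤ℕ crit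
      rk≤crit = ℕ.≮⇒≥ λ crit<rk → <-irrefl (sym (zero-above-crit z≥0 full isCrit ag crit<rk)) 0<z

      ¬InH : ∀ {c'} → IsCrit z' c' → rk g ≡ c' → ¬ InH z' g
      ¬InH {c'} cr'@(_ , q≤upto') rk≡c' h =
        <⇒≱ (sumWhere-mono-< (Upto c') z' z dominated (inUpto⁺ ag (ℕ.≤-reflexive rk≡c')) z'<z)
        (begin
          upto z c'   ≤⟨ upto≤load z≥0 c' ⟩
          load z      ≡⟨ full ⟩
          q           ≤⟨ q≤upto' ⟩
          upto z' c'  ∎)
        where
        open ≤-Reasoning
        rk≡crit : rk g ≡ crit
        rk≡crit = ℕ.≤-antisym rk≤crit (subst (crit ≤ℕ_) (sym rk≡c') (crit-≤ cr'))
        dominated : ∀ e → T (Upto c' e) → z' e ≤ z e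
        dominated e t with inUpto⁻ t
        ... | ae , le with ℕ.m≤n⇒m<n∨m≡n (subst (rk e ≤ℕ_) (trans (sym rk≡c') rk≡crit) le)
        ...   | inj₁ lt = below e ae lt
        ...   | inj₂ eq = ≤cap⇒≤ ae eq (begin
                  z' e ≤⟨ InH-max z'≥0 h ae (trans eq (sym rk≡crit)) ⟩
                  z' g ≤⟨ <⇒≤ z'<z ⟩
                  z g  ≤⟨ ≤cap ag rk≡crit ⟩
                  cap  ∎)

      InT-at : ∀ {c'} → IsCrit z' c' → InT z' g
      InT-at {c'} cr' with ℕ.<-cmp (rk g) c'
      ... | tri< lt _ _ = InT-below z'≥0 full' cr' ag lt
      ... | tri≈ _ eq _ = InT-crit z'≥0 full' cr' ag eq (¬InH cr' eq)
      ... | tri> _ _ gt = contradiction (ℕ.≤-trans rk≤crit (crit-≤ cr')) (ℕ.<⇒≱ gt)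

    module _ (full' : Full z') {c'} (cr' : IsCrit z' c') {p} (hp : InH z' p) (p↑ : z p < z' p) where

      -- An unchanged head e would give z' p = z' e = z e ≤ z p.
      heads-increase : ∀ {e} → InH z' e → z e < z' e
      heads-increase {e} he with <-cmp (z e) (z' e)
      ... | tri< lt _ _ = lt
      ... | tri> _ _ gt = contradiction (decrease⇒InT full' (InH-at z'≥0 he) gt) (InH⇒¬InT z'≥0 he)
      ... | tri≈ _ eq _ = contradiction z'p≤zp (<⇒≱ p↑)
        where
        rk-e≡c' : rk e ≡ c'
        rk-e≡c' = InH-rank z'≥0 he cr'
        z[e]≤z[p] : z e ≤ z p
        z[e]≤z[p] with ℕ.m≤n⇒m<n∨m≡n (crit-≤ cr')
        ... | inj₁ crit<c' = subst (_≤ z p)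
                (sym (zero-above-crit z≥0 full isCrit (InH-at z'≥0 he) (subst (crit <ℕ_) (sym rk-e≡c') crit<c')))
                (z≥0 p)
        ... | inj₂ crit≡c' = subst (z e ≤_)
                (sym (increase⇒cap (InH-at z'≥0 hp) (trans (InH-rank z'≥0 hp cr') (sym crit≡c')) p↑))
                (≤cap (InH-at z'≥0 he) (trans rk-e≡c' (sym crit≡c')))
        z'p≤zp : z' p ≤ z p
        z'p≤zp = begin
          z' p ≡⟨ InH-≡ z'≥0 hp he ⟩
          z' e ≡⟨ sym eq ⟩
          z e  ≤⟨ z[e]≤z[p] ⟩
          z p  ∎
          where open ≤-Reasoning

      head-⊆ : c' ≡ crit → ∀ {e} → InH z' e → InH z e
      head-⊆ c'≡crit {e} he = full , crit , isCrit , ae , rk≡crit , λ e' ae' eq' → begin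
        z e' ≤⟨ ≤cap ae' eq' ⟩
        cap  ≡⟨ sym (increase⇒cap ae rk≡crit (heads-increase he)) ⟩
        z e  ∎
        where
        open ≤-Reasoning
        ae : T (at e)
        ae = InH-at z'≥0 he
        rk≡crit : rk e ≡ crit
        rk≡crit = trans (InH-rank z'≥0 he cr') c'≡crit

  Prefers-load-≤ : ∀ {z z'} → Prefers z z' → load z' ≤ q → load z' ≤ load z
  Prefers-load-≤ {z} {z'} pref load'≤q with Prefers⇒≤⊎Cut pref
  ... | inj₁ z'≤z = sumWhere-mono-≤ at z' z z'≤z
  ... | inj₂ cut  = ≤-trans load'≤q (≤-reflexive (sym (Cut.full cut)))

  Prefers-decrease⇒InT : ∀ {z z'} → NonNeg z → NonNeg z' → load z ≤ q → Prefers z z' →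
                         ∀ {g} → T (at g) → z' g < z g → InT z' g
  Prefers-decrease⇒InT {z} {z'} z≥0 z'≥0 load≤q pref {g} ag lt with load z' ≟ q
  ... | no ¬full' = ag , inj₁ ¬full'
  ... | yes full' with Prefers⇒≤⊎Cut pref
  ...   | inj₁ z'≤z = contradiction (≤-trans load≤q (≤-reflexive (sym full')))
                                      (<⇒≱ (sumWhere-mono-< at z' z z'≤z ag lt))
  ...   | inj₂ cut  = CutProperties.decrease⇒InT z≥0 z'≥0 cut full' ag lt

-- Two stable assignments at distance ε

module Market (I : Instance) where
  open Model I

  module Firm (f : Fin nF) = Vertex (atF f) rF (qF f) (qF-pos f)
  module Worker (w : Fin nW) = Vertex (atW w) rW (qW w) (qW-pos w)

  atF-self : ∀ e → T (atF (fE e) e)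
  atF-self e = fromWitness refl

  atW-self : ∀ e → T (atW (wE e) e)
  atW-self e = fromWitness refl

  atF-eq : ∀ {f e} → T (atF f e) → fE e ≡ f
  atF-eq = toWitness

  atW-eq : ∀ {w e} → T (atW w e) → wE e ≡ w
  atW-eq = toWitness

  firms-total : ∀ z → ∑[ f < nF ] LF.load f z ≡ sum z
  firms-total = ∑-fibres fE

  workers-total : ∀ z → ∑[ w < nW ] LW.load w z ≡ sum z
  workers-total = ∑-fibres wE

  record Perturbation : Set where
    field
      x x' : Fin m → ℚ
      x≥0 : NonNeg x
      x≤b : ∀ e → x e ≤ b e
      x-firm-load : ∀ f → LF.load f x ≤ qF f
      x-worker-load : ∀ w → LW.load w x ≤ qW w
      x'≥0 : NonNeg x'
      x'≤b : ∀ e → x' e ≤ b e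
      x'-firm-load : ∀ f → LF.load f x' ≤ qF f
      x'-stable : ∀ e → x' e < b e → ¬ (LF.InT (fE e) x' e × LW.InT (wE e) x' e)
      x⪰x' : PrefF x x'
      ε : ℚ
      x-gap : ∀ e → x e ≢ 0ℚ → ε < x e
      slack-gap : ∀ e → b e - x e ≢ 0ℚ → ε < b e - x e
      head-gap : ∀ w → LW.Full w x → ∀ c → LW.IsCrit w x c → ∀ e e' →
                 LW.InH w x e → T (atW w e') → rW e' ≡ c → ¬ LW.InH w x e' → ε < x e - x e'
      distance : norm (λ e → x' e - x e) ≡ ε

  module PerturbationProperties (P : Perturbation) where
    open Perturbation P

    Δ : Fin m → ℚ
    Δ e = ∣ x' e - x e ∣

    Δ≥0 : NonNeg Δ
    Δ≥0 e = 0≤∣p∣ (x' e - x e)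

    Δ≤ε : ∀ e → Δ e ≤ ε
    Δ≤ε e = ≤-trans (term≤sumWhere Δ≥0 e) (≤-reflexive distance)

    x'≤x+ε : ∀ e → x' e ≤ x e + ε
    x'≤x+ε e = ≤-trans (p≤q+∣p-q∣ (x' e) (x e)) (+-monoʳ-≤ (x e) (Δ≤ε e))

    x≤x'+ε : ∀ e → x e ≤ x' e + ε
    x≤x'+ε e = ≤-trans (q≤p+∣p-q∣ (x' e) (x e)) (+-monoʳ-≤ (x' e) (Δ≤ε e))

    order-kept : ∀ {e h} → e ≢ h → x' h ≤ x' e → x h ≤ x e + ε
    order-kept {e} {h} e≢h x'h≤x'e = begin
      x h                   ≤⟨ q≤p+∣p-q∣ (x' h) (x h) ⟩
      x' h + Δ h            ≤⟨ +-monoˡ-≤ (Δ h) x'h≤x'e ⟩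
      x' e + Δ h            ≤⟨ +-monoˡ-≤ (Δ h) (p≤q+∣p-q∣ (x' e) (x e)) ⟩
      (x e + Δ e) + Δ h     ≡⟨ +-assoc (x e) (Δ e) (Δ h) ⟩
      x e + (Δ e + Δ h)     ≤⟨ +-monoʳ-≤ (x e) Δe+Δh≤ε ⟩
      x e + ε               ∎
      where
      open ≤-Reasoning
      Δe+Δh≤ε : Δ e + Δ h ≤ ε
      Δe+Δh≤ε = ≤-trans (pair≤sumWhere Δ≥0 e≢h) (≤-reflexive distance)

    slack-persists : ∀ {e} → x e < b e → x' e < b e
    slack-persists {e} x<b = ≤-<-trans (x'≤x+ε e) (r<q-p⇒p+r<q (slack-gap e (p<q⇒q-p≢0 x<b)))

    decrease⇒positive : ∀ {e} → x' e < x e → 0ℚ < x' e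
    decrease⇒positive {e} x'<x = ≰⇒> λ x'≤0 → <⇒≱ ε<x (begin
      x e         ≤⟨ x≤x'+ε e ⟩
      x' e + ε    ≤⟨ +-monoˡ-≤ ε x'≤0 ⟩
      0ℚ + ε      ≡⟨ +-identityˡ ε ⟩
      ε           ∎)
      where
      open ≤-Reasoning
      ε<x : ε < x e
      ε<x = x-gap e (λ x≡0 → <⇒≱ x'<x (subst (_≤ x' e) (sym x≡0) (x'≥0 e)))

    x'-unblocked : ∀ {f w e} → T (atF f e) → T (atW w e) → x' e < b e → LF.InT f x' e → ¬ LW.InT w x' e
    x'-unblocked af aw x'<b tf tw = x'-stable _ x'<b
      (subst (λ f → LF.InT f x' _) (sym (atF-eq af)) tf , subst (λ w → LW.InT w x' _) (sym (atW-eq aw)) tw)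

    decrease⇒firm-tail : ∀ {f g} → T (atF f g) → x' g < x g → LF.InT f x' g
    decrease⇒firm-tail {f} af = Firm.Prefers-decrease⇒InT f x≥0 x'≥0 (x-firm-load f) (x⪰x' f) af

    decrease⇒worker-head : ∀ {w g} → T (atW w g) → x' g < x g → LW.InH w x' g
    decrease⇒worker-head {w} {g} aw x'<x = Worker.positive-¬InT⇒InH w x'≥0 aw (decrease⇒positive x'<x)
      (x'-unblocked (atF-self g) aw (<-≤-trans x'<x (x≤b g)) (decrease⇒firm-tail (atF-self g) x'<x))

    worker-load-≤ : ∀ w → LW.load w x ≤ LW.load w x'
    worker-load-≤ w with LW.load w x' ≟ qW w
    ... | yes full' = ≤-trans (x-worker-load w) (≤-reflexive (sym full'))
    ... | no ¬full' = sumWhere-mono-≤ (atW w) x x'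
                        (λ e aw → ≮⇒≥ λ x'<x → ¬full' (proj₁ (decrease⇒worker-head aw x'<x)))

    firm-load-≤ : ∀ f → LF.load f x' ≤ LF.load f x
    firm-load-≤ f = Firm.Prefers-load-≤ f (x⪰x' f) (x'-firm-load f)

    firm-load-≡ : ∀ f → LF.load f x' ≡ LF.load f x
    firm-load-≡ = ∑-pointwise-≡ firm-load-≤ (begin
      ∑[ f < nF ] LF.load f x    ≡⟨ firms-total x ⟩
      sum x                      ≡⟨ workers-total x ⟨
      ∑[ w < nW ] LW.load w x    ≤⟨ ∑-mono-≤ worker-load-≤ ⟩
      ∑[ w < nW ] LW.load w x'   ≡⟨ workers-total x' ⟩
      sum x'                     ≡⟨ firms-total x' ⟨
      ∑[ f < nF ] LF.load f x'   ∎)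
      where open ≤-Reasoning

    worker-load-≡ : ∀ w → LW.load w x ≡ LW.load w x'
    worker-load-≡ = ∑-pointwise-≡ worker-load-≤ (begin
      ∑[ w < nW ] LW.load w x'   ≡⟨ workers-total x' ⟩
      sum x'                     ≡⟨ firms-total x' ⟨
      ∑[ f < nF ] LF.load f x'   ≤⟨ ∑-mono-≤ firm-load-≤ ⟩
      ∑[ f < nF ] LF.load f x    ≡⟨ firms-total x ⟩
      sum x                      ≡⟨ workers-total x ⟨
      ∑[ w < nW ] LW.load w x    ∎)
      where open ≤-Reasoning

    worker-full⇒ : ∀ {w} → LW.Full w x → LW.Full w x'
    worker-full⇒ {w} = trans (sym (worker-load-≡ w))

    worker-full⇐ : ∀ {w} → LW.Full w x' → LW.Full w x
    worker-full⇐ {w} = trans (worker-load-≡ w)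

    worker-crit-≡ : ∀ {w c c'} → LW.Full w x → LW.IsCrit w x c → LW.IsCrit w x' c' → c ≡ c'
    worker-crit-≡ {w} {c} {c'} full cr cr' = ℕ.≤-antisym (ℕ.≮⇒≥ c'≮c) (ℕ.≮⇒≥ c≮c')
      where
      open Worker w
      c≮c' : ¬ c <ℕ c'
      c≮c' c<c' =
        let g , t , x'<x = sumWhere-<⇒∃< (Upto c) x' x
              (≤-<-trans (upto≤before x'≥0 c<c') (<-≤-trans (proj₁ cr') (proj₂ cr)))
            ag , rk≤c = inUpto⁻ t
        in ℕ.<⇒≱ c<c' (subst (_≤ℕ c) (InH-rank x'≥0 (decrease⇒worker-head ag x'<x) cr') rk≤c)
      -- The critical tie of x carries an edge with x h > ε, which x' would have to empty.
      c'≮c : ¬ c' <ℕ c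
      c'≮c c'<c =
        let h , t , ¬t , 0<x = sumWhere-⊆-<⇒∃ (Before c) (Upto c) x
              (λ e t → let ae , lt = inBefore⁻ t in inUpto⁺ ae (ℕ.<⇒≤ lt))
              (<-≤-trans (proj₁ cr) (proj₂ cr))
            ah , rk≤c = inUpto⁻ t
            rk≡c = ℕ.≤-antisym rk≤c (ℕ.≮⇒≥ (¬t ∘ inBefore⁺ ah))
            x'≡0 = zero-above-crit x'≥0 (worker-full⇒ full) cr' ah (subst (c' <ℕ_) (sym rk≡c) c'<c)
        in <⇒≱ (x-gap h (λ x≡0 → <-irrefl (sym x≡0) 0<x)) (begin
             x h        ≤⟨ x≤x'+ε h ⟩
             x' h + ε   ≡⟨ cong (_+ ε) x'≡0 ⟩
             0ℚ + ε     ≡⟨ +-identityˡ ε ⟩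
             ε          ∎)
        where open ≤-Reasoning

    -- If e were not an x-head, head-gap would put the x-head h more than ε above it, yet x' ranks
    -- e at least as high as h and the two edges move by at most ε in total.
    worker-head-⊆ : ∀ {w e} → LW.InH w x' e → LW.InH w x e
    worker-head-⊆ {w} {e} he'@(full' , c' , cr' , ae , rk≡c' , _) = head-at (proj₂ (IsCrit-exists x≥0 full))
      where
      open Worker w
      full : LW.Full w x
      full = worker-full⇐ full'
      head-at : ∀ {c} → LW.IsCrit w x c → LW.InH w x e
      head-at {c} cr =
        let h , hh = InH-exists x≥0 full cr ae rk≡c
            rh≡re = trans (InH-rank x≥0 hh cr) (sym rk≡c)
            xh≤xe = ≮⇒≥ λ xe<xh →
              let ¬he : ¬ LW.InH w x e
                  ¬he he = <⇒≱ xe<xh (InH-max x≥0 he (InH-at x≥0 hh) rh≡re)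
                  e≢h : e ≢ h
                  e≢h e≡h = <-irrefl (cong x e≡h) xe<xh
              in <⇒≱ (r<q-p⇒p+r<q (head-gap w full c cr h e hh ae rk≡c ¬he))
                     (order-kept e≢h (InH-max x'≥0 he' (InH-at x≥0 hh) rh≡re))
        in full , c , cr , ae , rk≡c , λ e' ae' rk'≡c →
             ≤-trans (InH-max x≥0 hh ae' (trans rk'≡c (trans (sym rk≡c) (sym rh≡re)))) xh≤xe
        where
        rk≡c : rW e ≡ c
        rk≡c = trans rk≡c' (sym (worker-crit-≡ full cr cr'))

    worker-compensate : ∀ {w e} → T (atW w e) → x e < x' e → ∃ λ g → T (atW w g) × x' g < x g
    worker-compensate {w} ae x<x' = sumWhere-≢⇒∃< (atW w) x' x
      (≤-reflexive (sym (worker-load-≡ w))) (λ x'≡x → <-irrefl (sym (x'≡x _ ae)) x<x')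

    increase⇒¬worker-head' : ∀ {w e} → T (atW w e) → x e < x' e → ¬ LW.InH w x' e
    increase⇒¬worker-head' {w} {e} ae x<x' he' =
      let g , ag , x'<x = worker-compensate ae x<x'
          hg' = decrease⇒worker-head ag x'<x
      in <⇒≱ x'<x (begin
        x g   ≡⟨ InH-≡ x≥0 (worker-head-⊆ hg') (worker-head-⊆ he') ⟩
        x e   ≤⟨ <⇒≤ x<x' ⟩
        x' e  ≡⟨ InH-≡ x'≥0 he' hg' ⟩
        x' g  ∎)
      where
      open Worker w
      open ≤-Reasoning

    increase⇒¬worker-head : ∀ {w e} → x e < x' e → ¬ LW.InH w x e
    increase⇒¬worker-head {w} {e} x<x' he@(full , c , cr , ae , rk≡c , _) =
      let c' , cr' = IsCrit-exists x'≥0 (worker-full⇒ full)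
          rk≡c' = trans rk≡c (worker-crit-≡ full cr cr')
          h , hh' = InH-exists x'≥0 (worker-full⇒ full) cr' ae rk≡c'
      in increase⇒¬worker-head' (InH-at x'≥0 hh') (begin-strict
           x h   ≡⟨ InH-≡ x≥0 (worker-head-⊆ hh') he ⟩
           x e   <⟨ x<x' ⟩
           x' e  ≤⟨ InH-max x'≥0 hh' ae (trans rk≡c' (sym (InH-rank x'≥0 hh' cr'))) ⟩
           x' h  ∎) hh'
      where
      open Worker w
      open ≤-Reasoning

    increase⇒worker-tail : ∀ {w e} → T (atW w e) → x e < x' e → LW.InT w x e
    increase⇒worker-tail {w} {e} ae x<x' with LW.load w x ≟ qW w
    ... | no ¬full = ae , inj₁ ¬full
    ... | yes full = tail-at (proj₂ (IsCrit-exists x≥0 full)) (proj₂ (IsCrit-exists x'≥0 (worker-full⇒ full)))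
      where
      open Worker w
      tail-at : ∀ {c c'} → LW.IsCrit w x c → LW.IsCrit w x' c' → LW.InT w x e
      tail-at {c} cr cr' with ℕ.<-cmp (rW e) c
      ... | tri< lt _ _ = InT-below x≥0 full cr ae lt
      ... | tri≈ _ eq _ = InT-crit x≥0 full cr ae eq (increase⇒¬worker-head x<x')
      ... | tri> _ _ gt = contradiction
              (zero-above-crit x'≥0 (worker-full⇒ full) cr' ae (subst (_<ℕ rW e) (worker-crit-≡ full cr cr') gt))
              (λ x'≡0 → <⇒≱ x<x' (subst (_≤ x e) (sym x'≡0) (x≥0 e)))

    worker-tail-⊆ : ∀ {w e} → LW.InT w x e → LW.InT w x' e
    worker-tail-⊆ {w} {e} t@(ae , _) with LW.load w x ≟ qW w
    ... | no ¬full = ae , inj₁ (¬full ∘ worker-full⇐)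
    ... | yes full = tail-at (proj₂ (IsCrit-exists x≥0 full)) (proj₂ (IsCrit-exists x'≥0 full'))
      where
      open Worker w
      full' : LW.Full w x'
      full' = worker-full⇒ full
      tail-at : ∀ {c c'} → LW.IsCrit w x c → LW.IsCrit w x' c' → LW.InT w x' e
      tail-at {c} {c'} cr cr' =
        [ (λ lt → InT-below x'≥0 full' cr' ae (subst (rW e <ℕ_) c≡c' lt))
        , (λ (eq , ¬he) → InT-crit x'≥0 full' cr' ae (trans eq c≡c') (¬he ∘ worker-head-⊆))
        ]′ (InT-cases x≥0 t full cr)
        where
        c≡c' : c ≡ c'
        c≡c' = worker-crit-≡ full cr cr'

    deficit-worker-unchanged : ∀ {w e} → ¬ LW.Full w x → T (atW w e) → x' e ≡ x e
    deficit-worker-unchanged {w} {e} ¬full ae with <-cmp (x' e) (x e)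
    ... | tri≈ _ eq _ = eq
    ... | tri< x'<x _ _ = contradiction (worker-full⇐ (proj₁ (decrease⇒worker-head ae x'<x))) ¬full
    ... | tri> _ _ x<x' = let g , ag , x'<x = worker-compensate ae x<x'
                          in contradiction (worker-full⇐ (proj₁ (decrease⇒worker-head ag x'<x))) ¬full

    increase⇒firm-head : ∀ {f e} → T (atF f e) → x e < x' e → LF.InH f x' e
    increase⇒firm-head {f} {e} af x<x' = Firm.positive-¬InT⇒InH f x'≥0 af 0<x' λ tf →
      increase⇒¬worker-head' (atW-self e) x<x' (Worker.positive-¬InT⇒InH (wE e) x'≥0 (atW-self e) 0<x'
        (x'-unblocked af (atW-self e) (slack-persists (<-≤-trans x<x' (x'≤b e))) tf))
      where
      0<x' : 0ℚ < x' e
      0<x' = ≤-<-trans (x≥0 e) x<x'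

    module ChangedFirm (f : Fin nF) (full : LF.Full f x) where
      open Firm f

      full' : LF.Full f x'
      full' = trans (firm-load-≡ f) full

      some-increase : ¬ (∀ e → T (atF f e) → x' e ≡ x e) → ∃ λ p → T (atF f p) × x p < x' p
      some-increase changed = sumWhere-≢⇒∃< (atF f) x x' (≤-reflexive (sym (firm-load-≡ f)))
        (λ x≡x' → changed (λ e ae → sym (x≡x' e ae)))

      module Claims {p} (ap : T (atF f p)) (p↑ : x p < x' p) {c'} (cr' : LF.IsCrit f x' c') where

        cut : Cut x x'
        cut with Prefers⇒≤⊎Cut (x⪰x' f)
        ... | inj₁ x'≤x = contradiction (x'≤x p ap) (<⇒≱ p↑)
        ... | inj₂ cut  = cut

        open CutProperties x≥0 x'≥0 cut

        crit-mono : ∀ c c'' → LF.IsCrit f x c → LF.IsCrit f x' c'' → c ≤ℕ c''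
        crit-mono c c'' cr cr'' = subst (_≤ℕ c'') (IsCrit-unique x≥0 isCrit cr) (crit-≤ cr'')

        head-increases : ∀ {e} → LF.InH f x' e → x e < x' e
        head-increases = heads-increase full' cr' (increase⇒firm-head ap p↑) p↑

        head⇔increase : ∀ e → LF.InH f x' e ⇔ (T (atF f e) × x e < x' e)
        head⇔increase e =
          mk⇔ (λ he → InH-at x'≥0 he , head-increases he) (λ (ae , x<x') → increase⇒firm-head ae x<x')

        same-crit⇒head-⊆ : ∀ c → LF.IsCrit f x c → LF.IsCrit f x' c → ∀ e → LF.InH f x' e → LF.InH f x e
        same-crit⇒head-⊆ c cr cr'' e =
          head-⊆ full' cr'' (increase⇒firm-head ap p↑) p↑ (IsCrit-unique x≥0 cr isCrit)

        head⇒InDi : ∀ {e} → LF.InH f x' e → InDi f x c' e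
        head⇒InDi {e} he =
          InH-at x'≥0 he , InH-rank x'≥0 he cr' , <-≤-trans (head-increases he) (x'≤b e) ,
          increase⇒worker-tail (atW-self e) (head-increases he)

        crit'∈hatΠ : InHatPi f x c'
        crit'∈hatΠ = (p , head⇒InDi (increase⇒firm-head ap p↑)) , λ e ae rk≤c' x<b →
          decidable-stable (LW.load (wE e) x ≟ qW (wE e)) λ ¬full-w →
            let ¬tf : ¬ LF.InT f x' e
                ¬tf tf = x'-unblocked ae (atW-self e) (slack-persists x<b) tf
                           (atW-self e , inj₁ (¬full-w ∘ worker-full⇐))
                he : LF.InH f x' e
                he = [ (λ lt → contradiction (InT-below x'≥0 full' cr' ae lt) ¬tf) ,
                       (λ eq → ¬InT⇒InH x'≥0 full' cr' ae eq ¬tf) ]′ (ℕ.m≤n⇒m<n∨m≡n rk≤c')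
            in <-irrefl (sym (deficit-worker-unchanged ¬full-w (atW-self e))) (head-increases he)

        crit'-least : ∀ j → InHatPi f x j → c' ≤ℕ j
        crit'-least j ((e , ae , rk≡j , x<b , tw) , _) = ℕ.≮⇒≥ λ j<c' →
          x'-unblocked {f} {wE e} {e} ae (atW-self e) (slack-persists {e} x<b)
            (InT-below x'≥0 full' cr' ae (subst (_<ℕ c') (sym rk≡j) j<c')) (worker-tail-⊆ {wE e} {e} tw)

        crit'-is-hatπ : IsHatPi f x c'
        crit'-is-hatπ = crit'∈hatΠ , crit'-least

        D⇒head : ∀ {e} → InD f x e → LF.InH f x' e
        D⇒head {e} (i , (i∈hatΠ , i-least) , ae , rk≡i , x<b , tw) =
          ¬InT⇒InH x'≥0 full' cr' {e} ae (trans rk≡i i≡c')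
            λ tf → x'-unblocked {f} {wE e} {e} ae (atW-self e) (slack-persists {e} x<b) tf
                     (worker-tail-⊆ {wE e} {e} tw)
          where
          i≡c' : i ≡ c'
          i≡c' = ℕ.≤-antisym (i-least c' crit'∈hatΠ) (crit'-least i i∈hatΠ)

        head⇒D : ∀ {e} → LF.InH f x' e → InD f x e
        head⇒D he = c' , crit'-is-hatπ , head⇒InDi he

        head⇔D : ∀ e → LF.InH f x' e ⇔ InD f x e
        head⇔D e = mk⇔ head⇒D D⇒head

lemma4 : (I : Instance) → let open Model I in
    (x : Fin m → ℚ) → Stable x →
    (ε : ℚ) → 0ℚ < ε →
    (∀ e → x e ≢ 0ℚ → ε < x e) →
    (∀ e → b e - x e ≢ 0ℚ → ε < b e - x e) →
    (∀ w → LW.Full w x → ∀ c → LW.IsCrit w x c → ∀ e e' →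
       LW.InH w x e → T (atW w e') → rW e' ≡ c → ¬ LW.InH w x e' →
       ε < x e - x e') →
    (x' : Fin m → ℚ) → Stable x' → StrictPrefF x x' →
    norm (λ e → x' e - x e) ≡ ε →
    (f : Fin nF) → LF.Full f x → ¬ (∀ e → T (atF f e) → x' e ≡ x e) →
      (∀ c c' → LF.IsCrit f x c → LF.IsCrit f x' c' → c ≤ℕ c')
    × (∀ e → LF.InH f x' e ⇔ (T (atF f e) × x e < x' e))
    × (∀ c → LF.IsCrit f x c → LF.IsCrit f x' c →
         ∀ e → LF.InH f x' e → LF.InH f x e)
    × (Σ ℕ λ c' → LF.IsCrit f x' c' × IsHatPi f x c')
    × (∀ e → LF.InH f x' e ⇔ InD f x e)
lemma4 I x ((x≥0 , x≤b , x-firm-load , x-worker-load) , _) ε _ x-gap slack-gap head-gap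
       x' ((x'≥0 , x'≤b , x'-firm-load , _) , x'-stable) (x⪰x' , _) distance f full changed =
  crit-mono , head⇔increase , same-crit⇒head-⊆ , (proj₁ crit' , proj₂ crit' , crit'-is-hatπ) , head⇔D
  where
  open Model I
  open Market I
  P : Perturbation
  P = record
    { x = x ; x' = x' ; x≥0 = x≥0 ; x≤b = x≤b ; x-firm-load = x-firm-load ; x-worker-load = x-worker-load
    ; x'≥0 = x'≥0 ; x'≤b = x'≤b ; x'-firm-load = x'-firm-load ; x'-stable = x'-stable ; x⪰x' = x⪰x'
    ; ε = ε ; x-gap = x-gap ; slack-gap = slack-gap ; head-gap = head-gap ; distance = distance }
  open PerturbationProperties P
  open ChangedFirm f full
  increase : ∃ λ p → T (atF f p) × x p < x' p
  increase = some-increase changed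
  crit' : ∃ (LF.IsCrit f x')
  crit' = Firm.IsCrit-exists f x'≥0 full'
  open Claims (proj₁ (proj₂ increase)) (proj₂ (proj₂ increase)) (proj₂ crit')
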